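{- Let $(A,\rightarrow,\rightsquigarrow,1)$ be a pseudo-BE algebra and $s$ a Bosbach state on $A$. Then $\mathrm{Ker}(s)=\{x\in A\mid s(x)=1\}$ is a fantastic deductive system of $A$.
   Context: A pseudo-BE algebra is an algebra $(A,\rightarrow,\rightsquigarrow,1)$ of type $(2,2,0)$ such that for all $x,y,z\in A$: $x\rightarrow x=x\rightsquigarrow x=1$; $x\rightarrow 1=x\rightsquigarrow 1=1$; $1\rightarrow x=1\rightsquigarrow x=x$; $x\rightarrow(y\rightsquigarrow z)=y\rightsquigarrow(x\rightarrow z)$; $x\rightarrow y=1$ iff $x\rightsquigarrow y=1$. A Bosbach state is a map $s:A\to[0,1]$ with $s(1)=1$, $s(x)+s(x\rightarrow y)=s(y)+s(y\rightarrow x)$ and $s(x)+s(x\rightsquigarrow y)=s(y)+s(y\rightsquigarrow x)$ for all $x,y$. Put $x\vee_1 y=(x\rightarrow y)\rightsquigarrow y$, $x\vee_2 y=(x\rightsquigarrow y)\rightarrow y$. A deductive system is $D\subseteq A$ with $1\in D$ such that $x\in D$, $x\rightarrow y\in D$ imply $y\in D$. It is fantastic if for all $x,y$: $y\rightarrow x\in D$ implies $(x\vee_1 y)\rightarrow x\in D$, and $y\rightsquigarrow x\in D$ implies $(x\vee_2 y)\rightsquigarrow x\in D$. -}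

module Defs where

open import Level using (Level; _⊔_; suc)
open import Data.Product using (_×_; _,_)
open import Function.Bundles using (_⇔_)
open import Relation.Binary.PropositionalEquality using (_≡_)
open import Relation.Binary.Structures using (IsTotalOrder)
open import Algebra.Bundles using (CommutativeRing)

record PseudoBE (a : Level) : Set (suc a) where
  infixr 5 _⟶_ _⇝_
  field
    A     : Set a
    _⟶_   : A → A → A
    _⇝_   : A → A → A
    𝟙     : A
    refl⟶ : ∀ x → x ⟶ x ≡ 𝟙
    refl⇝ : ∀ x → x ⇝ x ≡ 𝟙
    top⟶  : ∀ x → x ⟶ 𝟙 ≡ 𝟙
    top⇝  : ∀ x → x ⇝ 𝟙 ≡ 𝟙
    unit⟶ : ∀ x → 𝟙 ⟶ x ≡ x
    unit⇝ : ∀ x → 𝟙 ⇝ x ≡ x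
    exch  : ∀ x y z → x ⟶ (y ⇝ z) ≡ y ⇝ (x ⟶ z)
    iff   : ∀ x y → (x ⟶ y ≡ 𝟙) ⇔ (x ⇝ y ≡ 𝟙)

  _∨₁_ : A → A → A
  x ∨₁ y = (x ⟶ y) ⇝ y

  _∨₂_ : A → A → A
  x ∨₂ y = (x ⇝ y) ⟶ y

  record IsDS {p : Level} (D : A → Set p) : Set (a ⊔ p) where
    field
      one∈ : D 𝟙
      mp   : ∀ {x y} → D x → D (x ⟶ y) → D y

  record IsFantasticDS {p : Level} (D : A → Set p) : Set (a ⊔ p) where
    field
      isDS  : IsDS D
      fant₁ : ∀ x y → D (y ⟶ x) → D ((x ∨₁ y) ⟶ x)
      fant₂ : ∀ x y → D (y ⇝ x) → D ((x ∨₂ y) ⇝ x)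

-- Ordered commutative ring: the value domain of states (ℝ is the intended
-- instance; agda-stdlib has no reals).
record OrderedCommRing (c ℓ₁ ℓ₂ : Level) : Set (suc (c ⊔ ℓ₁ ⊔ ℓ₂)) where
  field
    commRing : CommutativeRing c ℓ₁
  open CommutativeRing commRing public
  field
    _≤_          : Carrier → Carrier → Set ℓ₂
    isTotalOrder : IsTotalOrder _≈_ _≤_
    +-mono-≤     : ∀ {x y} z → x ≤ y → (x + z) ≤ (y + z)
    *-nonneg     : ∀ {x y} → 0# ≤ x → 0# ≤ y → 0# ≤ (x * y)
    0≤1          : 0# ≤ 1#

module _ {a c ℓ₁ ℓ₂ : Level} (P : PseudoBE a) (R : OrderedCommRing c ℓ₁ ℓ₂) where
  open PseudoBE P
  open OrderedCommRing R renaming (Carrier to ℝ)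

  record IsBosbachState (s : A → ℝ) : Set (a ⊔ ℓ₁ ⊔ ℓ₂) where
    field
      nonneg : ∀ x → 0# ≤ s x
      le-one : ∀ x → s x ≤ 1#
      s1     : s 𝟙 ≈ 1#
      bos⟶   : ∀ x y → s x + s (x ⟶ y) ≈ s y + s (y ⟶ x)
      bos⇝   : ∀ x y → s x + s (x ⇝ y) ≈ s y + s (y ⇝ x)

  Ker : (A → ℝ) → A → Set ℓ₁
  Ker s x = s x ≈ 1#

module Submission where

-- Two arithmetic facts about the ordered value ring drive everything: sums may
-- be cancelled, and if p, q ≤ 1 with p + q = 1 + 1 then p = 1.  With them the
-- Bosbach identity s x + s (x → y) = s y + s (y → x) yields
--   * modus ponens for the kernel (s x = s (x → y) = 1 forces s y = 1);
--   * a "converse" rule: if x → y = 1 and s x = s y then s (y → x) = 1;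
--   * the value of the join: s (x → y) + s (x ∨₁ y) = s y + 1, so that
--     s (y → x) = 1 gives s (x ∨₁ y) = s x.
-- Since x → (x ∨₁ y) = 1, the converse rule then puts (x ∨₁ y) → x in the
-- kernel, which is the first fantastic condition.  The second condition is
-- the first one for the dual pseudo-BE algebra obtained by swapping → and ⇝,
-- on which s is again a Bosbach state and ∨₁ becomes ∨₂.

open import Level using (Level)
open import Function.Bundles using (mk⇔; Equivalence)
open import Relation.Binary.PropositionalEquality as ≡ using (_≡_)
open import Relation.Binary.Structures using (IsTotalOrder)
import Algebra.Properties.Group as GroupProperties
import Relation.Binary.Reasoning.Setoid as SetoidReasoning
open import Defs

module OrderedArithmetic {c ℓ₁ ℓ₂ : Level} (R : OrderedCommRing c ℓ₁ ℓ₂) where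
  open OrderedCommRing R
  open IsTotalOrder isTotalOrder using (antisym; ≤-respˡ-≈; ≤-respʳ-≈)
  open GroupProperties +-group public using (∙-cancelˡ)
  open GroupProperties +-group using (//-rightDividesʳ)

  +-cancelʳ-≤ : ∀ {x y} z → (x + z) ≤ (y + z) → x ≤ y
  +-cancelʳ-≤ {x} {y} z x+z≤y+z =
    ≤-respˡ-≈ (//-rightDividesʳ z x)
      (≤-respʳ-≈ (//-rightDividesʳ z y) (+-mono-≤ (- z) x+z≤y+z))

  sum≈2⇒≈1 : ∀ {p q} → p ≤ 1# → q ≤ 1# → p + q ≈ 1# + 1# → p ≈ 1#
  sum≈2⇒≈1 {p} {q} p≤1 q≤1 p+q≈2 = antisym p≤1 (+-cancelʳ-≤ 1# 2≤p+1)
    where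
      2≤p+1 : (1# + 1#) ≤ (p + 1#)
      2≤p+1 = ≤-respˡ-≈ (trans (+-comm q p) p+q≈2)
                (≤-respʳ-≈ (+-comm 1# p) (+-mono-≤ p q≤1))

module PseudoBEFacts {a : Level} (P : PseudoBE a) where
  open PseudoBE P
  open ≡.≡-Reasoning

  ⇝-weaken : ∀ x y → y ⇝ (x ⟶ y) ≡ 𝟙
  ⇝-weaken x y = begin
    y ⇝ (x ⟶ y)   ≡⟨ ≡.sym (exch x y y) ⟩
    x ⟶ (y ⇝ y)   ≡⟨ ≡.cong (x ⟶_) (refl⇝ y) ⟩
    x ⟶ 𝟙         ≡⟨ top⟶ x ⟩
    𝟙             ∎

  ⟶-∨₁ : ∀ x y → x ⟶ (x ∨₁ y) ≡ 𝟙
  ⟶-∨₁ x y = ≡.trans (exch x (x ⟶ y) y) (refl⇝ (x ⟶ y))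

  dual : PseudoBE a
  dual = record
    { A     = A
    ; _⟶_   = _⇝_
    ; _⇝_   = _⟶_
    ; 𝟙     = 𝟙
    ; refl⟶ = refl⇝
    ; refl⇝ = refl⟶
    ; top⟶  = top⇝
    ; top⇝  = top⟶
    ; unit⟶ = unit⇝
    ; unit⇝ = unit⟶
    ; exch  = λ x y z → ≡.sym (exch y x z)
    ; iff   = λ x y → let open Equivalence (iff x y) in mk⇔ from to
    }

dualState : ∀ {a c ℓ₁ ℓ₂ : Level} (P : PseudoBE a) (R : OrderedCommRing c ℓ₁ ℓ₂)
            (s : PseudoBE.A P → OrderedCommRing.Carrier R) →
            IsBosbachState P R s → IsBosbachState (PseudoBEFacts.dual P) R s
dualState P R s st = record
  { nonneg = nonneg
  ; le-one = le-one
  ; s1     = s1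
  ; bos⟶   = bos⇝
  ; bos⇝   = bos⟶
  }
  where open IsBosbachState st

module KernelOfBosbachState {a c ℓ₁ ℓ₂ : Level} (P : PseudoBE a) (R : OrderedCommRing c ℓ₁ ℓ₂)
    (s : PseudoBE.A P → OrderedCommRing.Carrier R) (st : IsBosbachState P R s) where
  open PseudoBE P
  open PseudoBEFacts P using (⇝-weaken; ⟶-∨₁)
  open OrderedCommRing R
  open OrderedArithmetic R using (∙-cancelˡ; sum≈2⇒≈1)
  open IsBosbachState st
  open SetoidReasoning setoid

  ≡𝟙⇒ker : ∀ {x} → x ≡ 𝟙 → s x ≈ 1#
  ≡𝟙⇒ker ≡.refl = s1

  ker-mp : ∀ {x y} → s x ≈ 1# → s (x ⟶ y) ≈ 1# → s y ≈ 1#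
  ker-mp {x} {y} sx≈1 sxy≈1 = sum≈2⇒≈1 (le-one y) (le-one (y ⟶ x)) (begin
    s y + s (y ⟶ x)   ≈⟨ sym (bos⟶ x y) ⟩
    s x + s (x ⟶ y)   ≈⟨ +-cong sx≈1 sxy≈1 ⟩
    1# + 1#           ∎)

  ker-converse : ∀ {x y} → x ⟶ y ≡ 𝟙 → s x ≈ s y → s (y ⟶ x) ≈ 1#
  ker-converse {x} {y} x⟶y≡𝟙 sx≈sy = ∙-cancelˡ (s y) (s (y ⟶ x)) 1# (begin
    s y + s (y ⟶ x)   ≈⟨ sym (bos⟶ x y) ⟩
    s x + s (x ⟶ y)   ≈⟨ +-cong sx≈sy (≡𝟙⇒ker x⟶y≡𝟙) ⟩
    s y + 1#          ∎)

  s-∨₁ : ∀ x y → s (x ⟶ y) + s (x ∨₁ y) ≈ s y + 1#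
  s-∨₁ x y = begin
    s (x ⟶ y) + s (x ∨₁ y)     ≈⟨ bos⇝ (x ⟶ y) y ⟩
    s y + s (y ⇝ (x ⟶ y))      ≈⟨ +-congˡ (≡𝟙⇒ker (⇝-weaken x y)) ⟩
    s y + 1#                   ∎

  s-∨₁-ker : ∀ {x y} → s (y ⟶ x) ≈ 1# → s (x ∨₁ y) ≈ s x
  s-∨₁-ker {x} {y} syx≈1 = ∙-cancelˡ (s (x ⟶ y)) (s (x ∨₁ y)) (s x) (begin
    s (x ⟶ y) + s (x ∨₁ y)     ≈⟨ s-∨₁ x y ⟩
    s y + 1#                   ≈⟨ +-congˡ syx≈1 ⟨
    s y + s (y ⟶ x)            ≈⟨ bos⟶ x y ⟨
    s x + s (x ⟶ y)            ≈⟨ +-comm (s x) (s (x ⟶ y)) ⟩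
    s (x ⟶ y) + s x            ∎)

  ker-fantastic₁ : ∀ x y → s (y ⟶ x) ≈ 1# → s ((x ∨₁ y) ⟶ x) ≈ 1#
  ker-fantastic₁ x y syx≈1 = ker-converse (⟶-∨₁ x y) (sym (s-∨₁-ker syx≈1))

proposition5p9 : ∀ {a c ℓ₁ ℓ₂ : Level} (P : PseudoBE a) (R : OrderedCommRing c ℓ₁ ℓ₂)
    (s : PseudoBE.A P → OrderedCommRing.Carrier R) →
    IsBosbachState P R s → PseudoBE.IsFantasticDS P (Ker P R s)
proposition5p9 P R s st = record
  { isDS  = record { one∈ = s1 ; mp = ker-mp }
  ; fant₁ = ker-fantastic₁
  ; fant₂ = KernelOfBosbachState.ker-fantastic₁ (PseudoBEFacts.dual P) R s (dualState P R s st)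
  }
  where
    open IsBosbachState st using (s1)
    open KernelOfBosbachState P R s st using (ker-mp; ker-fantastic₁)
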